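{- Let $(A,+)$, $(B,+)$ be finite abelian groups with $n=|A|$, and let $f:A\to B$ be an $(n,\frac{n-1}{k}+1,k-1)$ zero-difference balanced function with $f(A)=\{b_0,\ldots,b_{m-1}\}$, $m=\frac{n-1}{k}+1$. Let $D_i=\{x\in A\mid f(x)=b_i\}$, $w_i=|D_i|$, and consider $\mathcal{D}=\{D_0,\ldots,D_{m-1}\}$ as an $(n,[w_0,\ldots,w_{m-1}],n-k+1)$ difference system of sets. If $n\ge\frac{k(k-1)}{2}+1$, then $\mathcal{D}$ is optimal.
   Context: $f$ is an $(n,m,\lambda)$ zero-difference balanced function if $m=|f(A)|$ and $|\{x\in A\mid f(x+\alpha)=f(x)\}|=\lambda$ for all $\alpha\in A\setminus\{0\}$. Disjoint subsets $D_0,\ldots,D_{q-1}$ of an abelian group $G$ of order $n$ with $|D_i|=w_i$ form an $(n,[w_0,\ldots,w_{q-1}],\rho)$ difference system of sets (DSS) if the multiset $\{x-y\mid x\in D_i,\ y\in D_j,\ i\neq j\}$ contains every nonzero element of $G$ at least $\rho$ times. With $\tau=\sum_i|D_i|$ and $q\ge2$, one has $\tau\ge\sqrt{\mathrm{SQUARE}(\rho(n-1)+\lceil\frac{\rho(n-1)}{q-1}\rceil)}$, where $\mathrm{SQUARE}(x)$ is the smallest perfect square not less than $x$; the DSS is optimal if equality holds. -}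

module Defs where

open import Level using (0ℓ)
open import Data.Bool using (Bool; true; false)
open import Data.Nat using (ℕ; zero; suc; _+_; _*_; _∸_; _/_; _≤_; _<_)
open import Data.Fin using (Fin)
open import Data.Fin.Properties using (_≟_; any?)
open import Data.Fin.Subset using (Subset; _∈_; ∣_∣)
open import Data.Fin.Subset.Properties using (_∈?_)
open import Data.List using (List; length; filter)
open import Data.Product using (Σ; ∃; _×_; _,_)
open import Data.Vec using (tabulate)
open import Relation.Nullary using (¬_; Dec; yes; no; does)
open import Relation.Nullary.Decidable using (_×-dec_; ¬?)
open import Relation.Unary using (Decidable)
open import Relation.Binary.PropositionalEquality using (_≡_)
open import Algebra.Structures using (IsAbelianGroup)
open import Data.List using (allFin)

-- A finite abelian group of order n, presented (up to isomorphism) on the carrier Fin n.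
record FinAbGroup (n : ℕ) : Set where
  field
    _+ᴳ_ : Fin n → Fin n → Fin n
    0ᴳ   : Fin n
    -ᴳ_  : Fin n → Fin n
    isAbelianGroup : IsAbelianGroup _≡_ _+ᴳ_ 0ᴳ -ᴳ_

  _-ᴳ_ : Fin n → Fin n → Fin n
  x -ᴳ y = x +ᴳ (-ᴳ y)

open FinAbGroup public

count : ∀ {n} {P : Fin n → Set} → Decidable P → ℕ
count {n} P? = length (filter P? (allFin n))

sumFin : ∀ {n} → (Fin n → ℕ) → ℕ
sumFin {zero}  g = 0
sumFin {suc n} g = g Fin.zero + sumFin {n} (λ i → g (Fin.suc i))

imageSize : ∀ {n nB} → (Fin n → Fin nB) → ℕ
imageSize {n} f = count (λ b → any? (λ x → f x ≟ b))

IsZDB : ∀ {n nB} (A : FinAbGroup n) (B : FinAbGroup nB) →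
        (Fin n → Fin nB) → (m l : ℕ) → Set
IsZDB {n} A B f m l =
  imageSize f ≡ m ×
  (∀ (α : Fin n) → ¬ (α ≡ 0ᴳ A) →
     count (λ x → f (_+ᴳ_ A x α) ≟ f x) ≡ l)

Disjoint : ∀ {n q} → (Fin q → Subset n) → Set
Disjoint {n} {q} D = ∀ (i j : Fin q) (x : Fin n) → x ∈ D i → x ∈ D j → i ≡ j

diffMult : ∀ {n q} (A : FinAbGroup n) → (Fin q → Subset n) → Fin n → ℕ
diffMult A D g =
  sumFin λ i → sumFin λ j → sumFin λ x →
    count (λ y → ¬? (i ≟ j) ×-dec ((x ∈? D i) ×-dec ((y ∈? D j) ×-dec (_-ᴳ_ A x y ≟ g))))

-- D is an (n, [w_0,...,w_{q-1}], ρ) difference system of sets in A (w_i = ∣ D i ∣)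
IsDSS : ∀ {n q} (A : FinAbGroup n) → (Fin q → Subset n) → (ρ : ℕ) → Set
IsDSS {n} A D ρ = Disjoint D × (∀ (g : Fin n) → ¬ (g ≡ 0ᴳ A) → ρ ≤ diffMult A D g)

-- ⌈ a / b ⌉ (only used with b ≥ 1)
ceilDiv : ℕ → ℕ → ℕ
ceilDiv a zero    = 0
ceilDiv a (suc b) = (a + b) / suc b

IsSQUARE : ℕ → ℕ → Set
IsSQUARE x s = (∃ λ t → s ≡ t * t) × x ≤ s × (∀ t → x ≤ t * t → s ≤ t * t)

tau : ∀ {n q} → (Fin q → Subset n) → ℕ
tau D = sumFin (λ i → ∣ D i ∣)

IsOptimalDSS : ∀ {n q} → (Fin q → Subset n) → (ρ : ℕ) → Set
IsOptimalDSS {n} {q} D ρ =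
  2 ≤ q × IsSQUARE (ρ * (n ∸ 1) + ceilDiv (ρ * (n ∸ 1)) (q ∸ 1)) (tau D * tau D)

fibre : ∀ {n nB m} → (Fin n → Fin nB) → (Fin m → Fin nB) → Fin m → Subset n
fibre f b i = tabulate (λ x → does (f x ≟ b i))

-- The blocks are the fibres of f, so they partition A and τ = n. Write n = ck + 1; then
-- ρ = n − k + 1 = (c − 1)k + 2, there are q = c + 1 blocks, ⌈ρ(n−1)/(q−1)⌉ = ρk, and the
-- quantity under SQUARE is X = ρk(c + 1) = n² − (k − 1)² = (n − 1)² + k(2c + 2 − k).
-- Hence SQUARE(X) = n² = τ² as soon as k ≤ 2c + 1, which is what n ≥ k(k − 1)/2 + 1 says.
module Submission where

open import Defs
open import Data.Nat using (ℕ; _+_; _*_; _∸_; _/_; _≤_; NonZero)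
open import Data.Nat.Divisibility using (_∣_)
open import Data.Fin using (Fin)
open import Data.Product using (∃; _×_)
open import Function.Definitions using (Injective)
open import Relation.Binary.PropositionalEquality using (_≡_)

open import Data.Bool using (Bool; true; false; if_then_else_)
open import Data.Empty using (⊥-elim)
open import Data.Fin using (zero; suc; punchIn)
open import Data.Fin.Properties using (_≟_; punchInᵢ≢i)
open import Data.Fin.Subset using (∣_∣)
open import Data.List using (_∷_; [])
open import Data.Nat using (suc; zero; _<_; s≤s)
open import Data.Nat.Divisibility using (divides)
open import Data.Nat.DivMod using (m*n/n≡m; m<n⇒m/n≡0; +-distrib-/-∣ˡ; /-monoˡ-≤)
open import Data.Nat.Properties hiding (_≟_)
open import Algebra.Properties.CommutativeMonoid.Sum +-0-commutativeMonoid
  using (sum; ∑-comm; sum-cong-≗; sum-remove; sum-replicate-zero)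
open import Data.Nat.Tactic.RingSolver using (solve; solve-∀)
open import Data.Product using (_,_)
open import Data.Vec using (tabulate)
open import Relation.Binary.PropositionalEquality
  using (refl; sym; trans; cong; cong₂; subst; _≢_; module ≡-Reasoning)
open import Relation.Nullary using (Dec; yes; no; does)

sumFin≡sum : ∀ {n} (g : Fin n → ℕ) → sumFin g ≡ sum g
sumFin≡sum {zero}  g = refl
sumFin≡sum {suc n} g = cong (g zero +_) (sumFin≡sum (λ i → g (suc i)))

sum-ones : ∀ n → sum {n} (λ _ → 1) ≡ n
sum-ones zero    = refl
sum-ones (suc n) = cong suc (sum-ones n)

sum-concentrated : ∀ {n} (g : Fin n → ℕ) (i : Fin n) →
  (∀ j → j ≢ i → g j ≡ 0) → sum g ≡ g i
sum-concentrated {suc n} g i vanish = begin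
  sum g                              ≡⟨ sum-remove g ⟩
  g i + sum (λ j → g (punchIn i j))  ≡⟨ cong (g i +_) (sum-cong-≗ {n} (λ j → vanish _ (punchInᵢ≢i i j))) ⟩
  g i + sum {n} (λ _ → 0)            ≡⟨ cong (g i +_) (sum-replicate-zero n) ⟩
  g i + 0                            ≡⟨ +-identityʳ (g i) ⟩
  g i                                ∎
  where open ≡-Reasoning

∣tabulate∣≡sum : ∀ {n} (p : Fin n → Bool) → ∣ tabulate p ∣ ≡ sum (λ x → if p x then 1 else 0)
∣tabulate∣≡sum {zero}  p = refl
∣tabulate∣≡sum {suc n} p with p zero
... | true  = cong suc (∣tabulate∣≡sum (λ x → p (suc x)))
... | false = ∣tabulate∣≡sum (λ x → p (suc x))

tau-fibre : ∀ {n nB q} (f : Fin n → Fin nB) (b : Fin q → Fin nB) → Injective _≡_ _≡_ b →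
  (∀ y → (∃ λ x → f x ≡ y) → ∃ λ i → b i ≡ y) → tau (fibre f b) ≡ n
tau-fibre {n} f b b-injective f-covered = begin
  sumFin (λ i → ∣ fibre f b i ∣)        ≡⟨ sumFin≡sum (λ i → ∣ fibre f b i ∣) ⟩
  sum (λ i → ∣ fibre f b i ∣)           ≡⟨ sum-cong-≗ (λ i → ∣tabulate∣≡sum (λ x → does (f x ≟ b i))) ⟩
  sum (λ i → sum (λ x → [ f x ≟ b i ])) ≡⟨ ∑-comm (λ i x → [ f x ≟ b i ]) ⟩
  sum (λ x → sum (λ i → [ f x ≟ b i ])) ≡⟨ sum-cong-≗ lies-in-one-fibre ⟩
  sum {n} (λ _ → 1)                     ≡⟨ sum-ones n ⟩
  n                                     ∎
  where
  open ≡-Reasoning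
  [_] : ∀ {P : Set} → Dec P → ℕ
  [ d ] = if does d then 1 else 0
  lies-in-one-fibre : ∀ x → sum (λ i → [ f x ≟ b i ]) ≡ 1
  lies-in-one-fibre x with f-covered (f x) (x , refl)
  ... | i , bi≡fx = begin
    sum (λ j → [ f x ≟ b j ]) ≡⟨ sum-concentrated (λ j → [ f x ≟ b j ]) i outside-other-fibres ⟩
    [ f x ≟ b i ]             ≡⟨ inside-own-fibre ⟩
    1                         ∎
    where
    inside-own-fibre : [ f x ≟ b i ] ≡ 1
    inside-own-fibre with f x ≟ b i
    ... | yes _   = refl
    ... | no fx≢bi = ⊥-elim (fx≢bi (sym bi≡fx))
    outside-other-fibres : ∀ j → j ≢ i → [ f x ≟ b j ] ≡ 0
    outside-other-fibres j j≢i with f x ≟ b j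
    ... | yes fx≡bj = ⊥-elim (j≢i (b-injective (trans (sym fx≡bj) (sym bi≡fx))))
    ... | no _      = refl

ceilDiv-*ˡ : ∀ a d → ceilDiv (a * suc d) (suc d) ≡ a
ceilDiv-*ˡ a d = begin
  (a * suc d + d) / suc d         ≡⟨ +-distrib-/-∣ˡ d (divides a refl) ⟩
  a * suc d / suc d + d / suc d   ≡⟨ cong₂ _+_ (m*n/n≡m a (suc d)) (m<n⇒m/n≡0 (n<1+n d)) ⟩
  a + 0                           ≡⟨ +-identityʳ a ⟩
  a                               ∎
  where open ≡-Reasoning

IsSQUARE-between : ∀ m x → m * m < x → x ≤ suc m * suc m → IsSQUARE x (suc m * suc m)
IsSQUARE-between m x m²<x x≤[1+m]² = (suc m , refl) , x≤[1+m]² , least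
  where
  least : ∀ t → x ≤ t * t → suc m * suc m ≤ t * t
  least t x≤t² with suc m ≤? t
  ... | yes m<t = *-mono-≤ m<t m<t
  ... | no m≮t  = ⊥-elim (<⇒≱ (≤-<-trans (*-mono-≤ t≤m t≤m) m²<x) x≤t²)
    where t≤m = ≤-pred (≰⇒> m≮t)

triangular-bound : ∀ c k → k * (k ∸ 1) / 2 ≤ c * k → k ≤ 2 * c + 1
triangular-bound c k h with k ≤? 2 * c + 1
... | yes k≤2c+1 = k≤2c+1
... | no  k≰2c+1 = ⊥-elim (<⇒≱ (≤-trans ck<k[k-1]/2 h) ≤-refl)
  where
  2c+1<k : 2 * c + 1 < k
  2c+1<k = ≰⇒> k≰2c+1
  2≤k : 2 ≤ k
  2≤k = ≤-trans (s≤s (m≤n+m 1 (2 * c))) 2c+1<k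
  doubled : (c * k + 1) * 2 ≤ k * (k ∸ 1)
  doubled = begin
    (c * k + 1) * 2  ≡⟨ solve (c ∷ k ∷ []) ⟩
    c * k * 2 + 2    ≤⟨ +-monoʳ-≤ (c * k * 2) 2≤k ⟩
    c * k * 2 + k    ≡⟨ solve (c ∷ k ∷ []) ⟩
    k * (2 * c + 1)  ≤⟨ *-monoʳ-≤ k (∸-monoˡ-≤ 1 2c+1<k) ⟩
    k * (k ∸ 1)      ∎
    where open ≤-Reasoning
  ck<k[k-1]/2 : c * k < k * (k ∸ 1) / 2
  ck<k[k-1]/2 = subst (_≤ k * (k ∸ 1) / 2) (trans (m*n/n≡m (c * k + 1) 2) (+-comm (c * k) 1))
                      (/-monoˡ-≤ 2 doubled)

square-bound : ∀ c' k' → suc k' ≤ 2 * suc c' + 1 →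
  IsSQUARE ((c' * suc k' + 2) * (suc c' * suc k') + (c' * suc k' + 2) * suc k')
           (suc (suc c' * suc k') * suc (suc c' * suc k'))
square-bound c' k' k≤2c+1 = IsSQUARE-between (c * k) x below above
  where
  c = suc c'
  k = suc k'
  x = (c' * k + 2) * (c * k) + (c' * k + 2) * k
  k<2c+2 : k < 2 * c + 2
  k<2c+2 = subst (k <_) (sym (+-suc (2 * c) 1)) (s≤s k≤2c+1)
  x+k²≡[ck]²+k[2c+2] : x + k * k ≡ c * k * (c * k) + k * (2 * c + 2)
  x+k²≡[ck]²+k[2c+2] = identity c' k'
    where
    identity : ∀ a b → (a * suc b + 2) * (suc a * suc b) + (a * suc b + 2) * suc b + suc b * suc b
                     ≡ suc a * suc b * (suc a * suc b) + suc b * (2 * suc a + 2)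
    identity = solve-∀
  x+k'²≡[ck+1]² : x + k' * k' ≡ suc (c * k) * suc (c * k)
  x+k'²≡[ck+1]² = identity c' k'
    where
    identity : ∀ a b → (a * suc b + 2) * (suc a * suc b) + (a * suc b + 2) * suc b + b * b
                     ≡ suc (suc a * suc b) * suc (suc a * suc b)
    identity = solve-∀
  below : c * k * (c * k) < x
  below = +-cancelʳ-< (k * k) (c * k * (c * k)) x
    (subst (c * k * (c * k) + k * k <_) (sym x+k²≡[ck]²+k[2c+2])
      (+-monoʳ-< (c * k * (c * k)) (*-monoʳ-< k k<2c+2)))
  above : x ≤ suc (c * k) * suc (c * k)
  above = subst (x ≤_) x+k'²≡[ck+1]² (m≤m+n x (k' * k'))

two-blocks : ∀ n k .{{_ : NonZero k}} → k ∣ n ∸ 1 → 2 ≤ n → 2 ≤ (n ∸ 1) / k + 1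
two-blocks zero                 k _                   ()
two-blocks (suc .(zero * k))    k (divides zero refl) (s≤s ())
two-blocks (suc .(suc c' * k))  k (divides (suc c') refl) _ =
  subst (λ q → 2 ≤ q + 1) (sym (m*n/n≡m (suc c') k)) (s≤s (m≤n+m 1 c'))

dss-bound-square : ∀ n k .{{_ : NonZero k}} → k ∣ n ∸ 1 → 2 ≤ n → k * (k ∸ 1) / 2 + 1 ≤ n →
  IsSQUARE ((n ∸ k + 1) * (n ∸ 1) + ceilDiv ((n ∸ k + 1) * (n ∸ 1)) ((n ∸ 1) / k + 1 ∸ 1)) (n * n)
dss-bound-square zero                      k         _                   ()
dss-bound-square (suc .(zero * k))         k         (divides zero refl) (s≤s ())
dss-bound-square (suc .(suc c' * suc k'))  (suc k')  (divides (suc c') refl) _ k[k-1]/2+1≤n =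
  subst (λ x → IsSQUARE x (suc (c * k) * suc (c * k))) (sym bound≡)
        (square-bound c' k' (triangular-bound c k k[k-1]/2≤ck))
  where
  open ≡-Reasoning
  c = suc c'
  k = suc k'
  ρ = c' * k + 2
  k[k-1]/2≤ck : k * k' / 2 ≤ c * k
  k[k-1]/2≤ck = ≤-pred (subst (_≤ suc (c * k)) (+-comm _ 1) k[k-1]/2+1≤n)
  n-k+1≡ρ : suc (c * k) ∸ k + 1 ≡ ρ
  n-k+1≡ρ = begin
    suc (k' + c' * k) ∸ k' + 1  ≡⟨ cong (λ m → m ∸ k' + 1) (sym (+-suc k' (c' * k))) ⟩
    k' + suc (c' * k) ∸ k' + 1  ≡⟨ cong (_+ 1) (m+n∸m≡n k' (suc (c' * k))) ⟩
    suc (c' * k) + 1            ≡⟨ sym (+-suc (c' * k) 1) ⟩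
    ρ                           ∎
  q-1≡c : c * k / k + 1 ∸ 1 ≡ c
  q-1≡c = trans (m+n∸n≡m (c * k / k) 1) (m*n/n≡m c k)
  ρ[ck]≡ρk*c : ρ * (c * k) ≡ ρ * k * c
  ρ[ck]≡ρk*c = trans (cong (ρ *_) (*-comm c k)) (sym (*-assoc ρ k c))
  bound≡ : (suc (c * k) ∸ k + 1) * (c * k) + ceilDiv ((suc (c * k) ∸ k + 1) * (c * k)) (c * k / k + 1 ∸ 1)
         ≡ ρ * (c * k) + ρ * k
  bound≡ = begin
    (suc (c * k) ∸ k + 1) * (c * k) + ceilDiv ((suc (c * k) ∸ k + 1) * (c * k)) (c * k / k + 1 ∸ 1)
      ≡⟨ cong₂ (λ r q → r * (c * k) + ceilDiv (r * (c * k)) q) n-k+1≡ρ q-1≡c ⟩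
    ρ * (c * k) + ceilDiv (ρ * (c * k)) c
      ≡⟨ cong (λ m → ρ * (c * k) + ceilDiv m c) ρ[ck]≡ρk*c ⟩
    ρ * (c * k) + ceilDiv (ρ * k * c) c
      ≡⟨ cong (ρ * (c * k) +_) (ceilDiv-*ˡ (ρ * k) c') ⟩
    ρ * (c * k) + ρ * k
      ∎

theorem7 : ∀ {n nB} (A : FinAbGroup n) (B : FinAbGroup nB)
    (k : ℕ) .{{_ : NonZero k}} → k ∣ (n ∸ 1) → 2 ≤ n →
    (f : Fin n → Fin nB) →
    IsZDB A B f ((n ∸ 1) / k + 1) (k ∸ 1) →
    (b : Fin ((n ∸ 1) / k + 1) → Fin nB) → Injective _≡_ _≡_ b →
    (∀ y → (∃ λ x → f x ≡ y) → ∃ λ i → b i ≡ y) →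
    (∀ i → ∃ λ x → f x ≡ b i) →
    IsDSS A (fibre f b) (n ∸ k + 1) →
    k * (k ∸ 1) / 2 + 1 ≤ n →
    IsOptimalDSS (fibre f b) (n ∸ k + 1)
theorem7 {n} A B k k∣n-1 2≤n f _ b b-injective f-covered _ _ k[k-1]/2+1≤n =
  two-blocks n k k∣n-1 2≤n ,
  subst (λ t → IsSQUARE _ (t * t)) (sym (tau-fibre f b b-injective f-covered))
        (dss-bound-square n k k∣n-1 2≤n k[k-1]/2+1≤n)
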